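{- Every combinatorial sphere is orientable.
   Context: A simplicial complex is a finite nonempty collection of finite sets closed under subsets (so it contains $\emptyset$); $\dim\sigma=|\sigma|-1$; $\alpha$ is a facet of $\beta$ if $\alpha\subseteq\beta$ and $\dim\alpha=\dim\beta-1$. A total order on the vertices is fixed; a $q$-simplex with vertices $x_0<\dots<x_q$ is the oriented simplex $[x_0,\dots,x_q]$; $C_q$ is the free $\mathbb Z$-module on the $q$-simplices ($q\ge0$). For a $q$-simplex $\sigma=[x_0,\dots,x_q]$ and a $(q-1)$-simplex $\tau$, $[\sigma,\tau]=(-1)^i$ if $\tau=\sigma\setminus\{x_i\}$, $0$ if $\tau\not\subseteq\sigma$; $\partial_q\sigma=\sum_\tau[\sigma,\tau]\tau$ for $q\ge1$, $\partial_0=0$. A discrete vector field $\mathcal V$ is a set of pairs $(\alpha,\beta)$ of simplices ($\alpha=\emptyset$ allowed) with $\alpha$ a facet of $\beta$, each simplex in at most one pair. A $\mathcal V$-trajectory is a sequence $\beta_0,\alpha_1,\beta_1,\dots,\alpha_r,\beta_r$ of alternately $q$- and $(q-1)$-simplices with $(\alpha_i,\beta_i)\in\mathcal V$, $\alpha_i\subsetneq\beta_{i-1}$, $\beta_{i-1}\ne\beta_i$; nontrivial closed if $r>0$ and $\beta_r=\beta_0$. A gradient vector field has no nontrivial closed trajectory. A nonempty simplex is critical if it lies in no pair, or is a $0$-simplex $\sigma$ with $(\emptyset,\sigma)\in\mathcal V$. A $d$-dimensional pseudomanifold: all maximal simplices have dimension $d$, every $(d-1)$-simplex lies in exactly two $d$-simplices,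 and any two $d$-simplices are joined by a sequence of $d$-simplices with consecutive ones meeting in a $(d-1)$-simplex. A combinatorial $d$-sphere is a $d$-dimensional pseudomanifold admitting a gradient vector field with exactly two critical simplices, one $d$-dimensional and one $0$-dimensional. If $\sigma_1,\dots,\sigma_n$ are the $d$-simplices of a combinatorial $d$-sphere $\mathcal S$, an orientation of $\mathcal S$ is a tuple $(\xi_1,\dots,\xi_n)\in\{\pm1\}^n$ with $\partial_d(\sum_i\xi_i\sigma_i)=0$; $\mathcal S$ is orientable if it has an orientation. -}

module Defs where

open import Data.Nat as ℕ using (ℕ; zero; suc; _<_)
open import Data.Integer as ℤ using (ℤ; 0ℤ; 1ℤ; -1ℤ; -_)
open import Data.Fin using (Fin; toℕ)
open import Data.List using (List; []; _∷_; length; removeAt; allFin; map; foldr; filter)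
import Data.List.Properties as LP
open import Data.List.Membership.Propositional using (_∈_)
open import Data.List.Relation.Unary.Linked using (Linked)
open import Data.List.Relation.Unary.Unique.Propositional using (Unique)
open import Data.Product using (Σ; ∃; ∃-syntax; _×_; _,_; proj₁; proj₂)
open import Data.Sum using (_⊎_)
open import Data.Unit using (⊤)
open import Data.Empty using (⊥)
open import Relation.Nullary using (¬_; Dec; yes; no)
open import Relation.Binary.PropositionalEquality using (_≡_; _≢_)

-- Vertices are natural numbers, with the fixed total order _<_ of ℕ.
-- A simplex (finite set of vertices) is represented canonically by the
-- strictly increasing list of its vertices x₀ < … < x_q; this list is
-- simultaneously the oriented simplex [x₀,…,x_q].

Simplex : Set
Simplex = List ℕ

Canonical : Simplex → Set
Canonical σ = Linked _<_ σ

_⊆ˢ_ : Simplex → Simplex → Set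
τ ⊆ˢ σ = ∀ x → x ∈ τ → x ∈ σ

_⊊ˢ_ : Simplex → Simplex → Set
τ ⊊ˢ σ = (τ ⊆ˢ σ) × (τ ≢ σ)

-- "σ is a q-simplex" : dim σ = |σ| - 1 = q, i.e. |σ| = q + 1
-- (the empty simplex has dimension -1 and is never a q-simplex, q ≥ 0)
IsDim : ℕ → Simplex → Set
IsDim q σ = length σ ≡ suc q

Facet : Simplex → Simplex → Set
Facet α β = (α ⊆ˢ β) × (length β ≡ suc (length α))

record Complex : Set where
  field
    simplices : List Simplex
    canonical : ∀ σ → σ ∈ simplices → Canonical σ
    distinct  : Unique simplices
    nonempty  : ∃[ σ ] (σ ∈ simplices)
    closed    : ∀ σ τ → σ ∈ simplices → Canonical τ → τ ⊆ˢ σ → τ ∈ simplices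
open Complex public

InPair : Simplex → Simplex × Simplex → Set
InPair σ (α , β) = (σ ≡ α) ⊎ (σ ≡ β)

record DiscreteVectorField (K : Complex) : Set where
  field
    pairs    : List (Simplex × Simplex)
    pair-in  : ∀ α β → (α , β) ∈ pairs → (α ∈ simplices K) × (β ∈ simplices K)
    facet    : ∀ α β → (α , β) ∈ pairs → Facet α β
    atMostOne : ∀ σ p p′ → p ∈ pairs → p′ ∈ pairs → InPair σ p → InPair σ p′ → p ≡ p′
open DiscreteVectorField public

-- A V-trajectory β₀, α₁, β₁, …, α_r, β_r, encoded by β₀ together with
-- the list [(α₁,β₁), …, (α_r,β_r)].  `Steps V b ps` says that the list
-- ps continues a trajectory whose current simplex is b.
data Steps {K : Complex} (V : DiscreteVectorField K) : Simplex → List (Simplex × Simplex) → Set where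
  done : ∀ {b} → Steps V b []
  step : ∀ {b α β ps} → (α , β) ∈ pairs V → α ⊊ˢ b → b ≢ β
       → Steps V β ps → Steps V b ((α , β) ∷ ps)

endOf : Simplex → List (Simplex × Simplex) → Simplex
endOf b []             = b
endOf b ((α , β) ∷ ps) = endOf β ps

data SameDim (n : ℕ) : List (Simplex × Simplex) → Set where
  []  : SameDim n []
  _∷_ : ∀ {α β ps} → length β ≡ n → SameDim n ps → SameDim n ((α , β) ∷ ps)

record Trajectory {K : Complex} (V : DiscreteVectorField K) : Set where
  field
    β₀      : Simplex
    β₀∈K    : β₀ ∈ simplices K
    β₀-dim  : ∃[ q ] IsDim q β₀
    rest    : List (Simplex × Simplex)
    valid   : Steps V β₀ rest
    samedim : SameDim (length β₀) rest
open Trajectory public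

NontrivialClosed : {K : Complex} {V : DiscreteVectorField K} → Trajectory V → Set
NontrivialClosed t = (rest t ≢ []) × (endOf (β₀ t) (rest t) ≡ β₀ t)

Gradient : {K : Complex} → DiscreteVectorField K → Set
Gradient V = ∀ (t : Trajectory V) → ¬ NontrivialClosed t

Critical : {K : Complex} → DiscreteVectorField K → Simplex → Set
Critical {K} V σ =
  (σ ∈ simplices K) × (σ ≢ []) ×
  ((∀ p → p ∈ pairs V → ¬ InPair σ p) ⊎ (IsDim 0 σ × (([] , σ) ∈ pairs V)))

Maximal : Complex → Simplex → Set
Maximal K σ = (σ ∈ simplices K) × (∀ τ → τ ∈ simplices K → ¬ (σ ⊊ˢ τ))

data Joined (K : Complex) (d : ℕ) : Simplex → Simplex → Set where
  here : ∀ {σ} → Joined K d σ σ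
  next : ∀ {σ τ ρ} → τ ∈ simplices K → IsDim d τ
       → (∃[ γ ] ((γ ∈ simplices K) × (length γ ≡ d) × (γ ⊆ˢ σ) × (γ ⊆ˢ τ)
                   × (∀ x → x ∈ σ → x ∈ τ → x ∈ γ)))
       → Joined K d τ ρ → Joined K d σ ρ

record Pseudomanifold (K : Complex) (d : ℕ) : Set where
  field
    pure     : ∀ σ → Maximal K σ → IsDim d σ
    twoCofaces : ∀ τ → τ ∈ simplices K → length τ ≡ d →
      ∃[ σ₁ ] ∃[ σ₂ ] ((σ₁ ∈ simplices K) × IsDim d σ₁ × (τ ⊆ˢ σ₁)
                     × (σ₂ ∈ simplices K) × IsDim d σ₂ × (τ ⊆ˢ σ₂)
                     × (σ₁ ≢ σ₂)
                     × (∀ σ → σ ∈ simplices K → IsDim d σ → τ ⊆ˢ σ → (σ ≡ σ₁) ⊎ (σ ≡ σ₂)))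
    connected : ∀ σ τ → σ ∈ simplices K → IsDim d σ → τ ∈ simplices K → IsDim d τ → Joined K d σ τ
open Pseudomanifold public

record CombinatorialSphere (K : Complex) (d : ℕ) : Set where
  field
    pseudo : Pseudomanifold K d
    V      : DiscreteVectorField K
    gradient : Gradient V
    top    : Simplex
    vertex : Simplex
    top-crit : Critical V top
    top-dim  : IsDim d top
    vertex-crit : Critical V vertex
    vertex-dim  : IsDim 0 vertex
    distinct-crit : top ≢ vertex
    onlyTwo : ∀ σ → Critical V σ → (σ ≡ top) ⊎ (σ ≡ vertex)

sumℤ : List ℤ → ℤ
sumℤ = foldr ℤ._+_ 0ℤ

sign : ℕ → ℤ
sign zero    = 1ℤ
sign (suc i) = - sign i

incidence : Simplex → Simplex → ℤ
incidence σ τ = sumℤ (map term (allFin (length σ)))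
  where
  term : Fin (length σ) → ℤ
  term i with LP.≡-dec ℕ._≟_ (removeAt σ i) τ
  ... | yes _ = sign (toℕ i)
  ... | no  _ = 0ℤ

dSimplices : Complex → ℕ → List Simplex
dSimplices K d = filter (λ σ → length σ ℕ.≟ suc d) (simplices K)

boundaryCoeff : Complex → (d : ℕ) → (Simplex → ℤ) → Simplex → ℤ
boundaryCoeff K d ξ τ = sumℤ (map (λ σ → ξ σ ℤ.* incidence σ τ) (dSimplices K d))

BoundaryZero : Complex → ℕ → (Simplex → ℤ) → Set
BoundaryZero K zero    ξ = ⊤
BoundaryZero K (suc e) ξ = ∀ τ → τ ∈ simplices K → IsDim e τ → boundaryCoeff K (suc e) ξ τ ≡ 0ℤ

Orientation : Complex → ℕ → Set
Orientation K d = Σ (Simplex → ℤ) λ ξ →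
  (∀ σ → σ ∈ simplices K → IsDim d σ → (ξ σ ≡ 1ℤ) ⊎ (ξ σ ≡ -1ℤ)) × BoundaryZero K d ξ

Orientable : Complex → ℕ → Set
Orientable K d = Orientation K d

-- Let d ≥ 1. Every d-simplex β other than the critical one, top, is paired with a facet lower β
-- (it cannot be paired upwards), and lower β lies in exactly one other d-simplex, across β.
-- The chain β, across β, across² β, … runs backwards along a V-trajectory, so, V being a gradient,
-- it reaches top. Propagating from top the sign that makes β and across β induce opposite
-- orientations on lower β gives ξ : d-simplices → {±1} whose boundary vanishes at every simplex
-- paired upwards. Every other (d-1)-simplex τ in the support of ∂ξ is paired downwards (or is the
-- critical vertex, when d = 1), and ∂∂ξ = 0 at lower τ yields another simplex of the support
-- containing lower τ: an endless backward V-trajectory, which is again impossible. When d = 1, the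
-- augmentation [v, ∅] = 1 excludes a support consisting of the critical vertex alone.
module Submission where

open import Data.Nat as ℕ using (ℕ; zero; suc; _≤_; _<_)
open import Data.Nat.GeneralisedArithmetic using (fold; iterate-is-fold)
import Data.Nat.Properties as ℕₚ
open import Data.Empty using (⊥; ⊥-elim)
open import Data.Fin as Fin using (Fin; toℕ)
open import Data.Fin.Properties using (pigeonhole; toℕ≤pred[n])
open import Data.Integer using (ℤ; 0ℤ; 1ℤ; -1ℤ; -_; _+_; _*_; _-_)
import Data.Integer.Properties as ℤₚ
open import Data.Integer.Solver using (module +-*-Solver)
open import Data.List using (List; []; _∷_; length; removeAt; allFin; map; lookup)
open import Data.List.Extrema ℕₚ.≤-totalOrder using (argmax; argmax-sel; f[xs]≤f[argmax])
import Data.List.Properties as Listₚ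
open import Data.List.Membership.Propositional using (_∈_; _∉_; find; lose)
import Data.List.Membership.Propositional.Properties as ∈ₚ
open import Data.List.Relation.Binary.Equality.Propositional using (≋⇒≡)
open import Data.List.Relation.Binary.Subset.DecPropositional ℕ._≟_ using (_⊆?_)
import Data.List.Relation.Binary.Sublist.Propositional as Sublist
import Data.List.Relation.Binary.Sublist.Propositional.Properties as Sublistₚ
open import Data.List.Relation.Unary.All as All using (All; _∷_)
open import Data.List.Relation.Unary.AllPairs using (AllPairs; []; _∷_)
open import Data.List.Relation.Unary.Any as Any using (Any; here; there; any?)
open import Data.List.Relation.Unary.Any.Properties using (lookup-index)
import Data.List.Relation.Unary.Linked as Linked
open import Data.List.Relation.Unary.Linked.Properties using (Linked⇒AllPairs; AllPairs⇒Linked)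
open import Data.List.Relation.Unary.Unique.Propositional using (Unique)
import Data.List.Relation.Unary.Unique.Propositional.Properties as Uniqueₚ
open import Data.Product using (Σ; ∃-syntax; _×_; _,_; proj₁; proj₂)
open import Data.Sum using (_⊎_; inj₁; inj₂; [_,_])
open import Data.Unit using (tt)
open import Function using (_∘_)
open import Relation.Binary.Definitions using (DecidableEquality)
open import Relation.Binary.PropositionalEquality
  using (_≡_; _≢_; refl; sym; trans; cong; cong₂; subst; module ≡-Reasoning)
open import Relation.Nullary using (¬_; Dec; yes; no; contradiction; ¬?; _×-dec_; _⊎-dec_; map′)
open import Relation.Nullary.Decidable using (decidable-stable)
open import Relation.Unary using (Decidable)

open import Defs

IsUnit : ℤ → Set
IsUnit z = (z ≡ 1ℤ) ⊎ (z ≡ -1ℤ)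

IsUnit-neg : ∀ {a} → IsUnit a → IsUnit (- a)
IsUnit-neg (inj₁ refl) = inj₂ refl
IsUnit-neg (inj₂ refl) = inj₁ refl

IsUnit-* : ∀ {a b} → IsUnit a → IsUnit b → IsUnit (a * b)
IsUnit-* (inj₁ refl) (inj₁ refl) = inj₁ refl
IsUnit-* (inj₁ refl) (inj₂ refl) = inj₂ refl
IsUnit-* (inj₂ refl) (inj₁ refl) = inj₂ refl
IsUnit-* (inj₂ refl) (inj₂ refl) = inj₁ refl

IsUnit⇒≢0 : ∀ {a} → IsUnit a → a ≢ 0ℤ
IsUnit⇒≢0 (inj₁ refl) ()
IsUnit⇒≢0 (inj₂ refl) ()

IsUnit-cancel : ∀ {b} → IsUnit b → ∀ a x → - (a * b) * x * b + x * a ≡ 0ℤ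
IsUnit-cancel (inj₁ refl) = solve 2 (λ a x → :- (a :* con 1ℤ) :* x :* con 1ℤ :+ x :* a := con 0ℤ) refl
  where open +-*-Solver
IsUnit-cancel (inj₂ refl) = solve 2 (λ a x → :- (a :* con -1ℤ) :* x :* con -1ℤ :+ x :* a := con 0ℤ) refl
  where open +-*-Solver

*≢0 : ∀ {a b} → a ≢ 0ℤ → b ≢ 0ℤ → a * b ≢ 0ℤ
*≢0 {a} a≢0 b≢0 ab≡0 = [ a≢0 , b≢0 ] (ℤₚ.i*j≡0⇒i≡0∨j≡0 a ab≡0)

*≢0⇒≢0ˡ : ∀ {a b} → a * b ≢ 0ℤ → a ≢ 0ℤ
*≢0⇒≢0ˡ {b = b} ab≢0 a≡0 = ab≢0 (trans (cong (_* b) a≡0) (ℤₚ.*-zeroˡ b))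

*≢0⇒≢0ʳ : ∀ {a b} → a * b ≢ 0ℤ → b ≢ 0ℤ
*≢0⇒≢0ʳ {a} ab≢0 b≡0 = ab≢0 (trans (cong (a *_) b≡0) (ℤₚ.*-zeroʳ a))

module _ {A : Set} (xs : List A) (f : ℕ → A) (f∈ : ∀ m → m ≤ length xs → f m ∈ xs) where

  private
    position : Fin (suc (length xs)) → Fin (length xs)
    position i = Any.index (f∈ (toℕ i) (toℕ≤pred[n] i))

    f≡lookup : ∀ i → f (toℕ i) ≡ lookup xs (position i)
    f≡lookup i = lookup-index (f∈ (toℕ i) (toℕ≤pred[n] i))

  ∈-pigeonhole : ∃[ a ] ∃[ k ] (suc k ℕ.+ a ≤ length xs × f (suc k ℕ.+ a) ≡ f a)
  ∈-pigeonhole with pigeonhole (ℕₚ.n<1+n (length xs)) position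
  ... | i , j , i<j , same with ℕₚ.m≤n⇒∃[o]m+o≡n i<j
  ...   | k , i+k≡j = toℕ i , k , subst (_≤ length xs) (sym k+i≡j) (toℕ≤pred[n] j) , returns
    where
    open ≡-Reasoning
    k+i≡j : suc k ℕ.+ toℕ i ≡ toℕ j
    k+i≡j = trans (cong suc (ℕₚ.+-comm k (toℕ i))) i+k≡j
    returns : f (suc k ℕ.+ toℕ i) ≡ f (toℕ i)
    returns = begin
      f (suc k ℕ.+ toℕ i)     ≡⟨ cong f k+i≡j ⟩
      f (toℕ j)               ≡⟨ f≡lookup j ⟩
      lookup xs (position j)  ≡⟨ cong (lookup xs) same ⟨
      lookup xs (position i)  ≡⟨ f≡lookup i ⟨
      f (toℕ i)               ∎

select : {A : Set} {P : A → Set} → Decidable P → A → List A → A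
select P? fallback xs with any? P? xs
... | yes found = proj₁ (find found)
... | no  _     = fallback

select-spec : ∀ {A : Set} {P : A → Set} (P? : Decidable P) fallback {xs} →
              Any P xs → select P? fallback xs ∈ xs × P (select P? fallback xs)
select-spec P? fallback {xs} found′ with any? P? xs
... | yes found = proj₂ (find found)
... | no  none  = contradiction found′ none

sumOver : {A : Set} → List A → (A → ℤ) → ℤ
sumOver xs f = sumℤ (map f xs)

module _ {A : Set} where

  sumOver-cong : ∀ (xs : List A) {f g : A → ℤ} → (∀ x → x ∈ xs → f x ≡ g x) → sumOver xs f ≡ sumOver xs g
  sumOver-cong []       _   = refl
  sumOver-cong (x ∷ xs) f≗g = cong₂ _+_ (f≗g x (here refl)) (sumOver-cong xs (λ y → f≗g y ∘ there))

  sumOver-zero : ∀ (xs : List A) {f : A → ℤ} → (∀ x → x ∈ xs → f x ≡ 0ℤ) → sumOver xs f ≡ 0ℤ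
  sumOver-zero []       _   = refl
  sumOver-zero (x ∷ xs) f≗0 = cong₂ _+_ (f≗0 x (here refl)) (sumOver-zero xs (λ y → f≗0 y ∘ there))

  sumOver-+ : ∀ (xs : List A) (f g : A → ℤ) → sumOver xs (λ x → f x + g x) ≡ sumOver xs f + sumOver xs g
  sumOver-+ []       f g = refl
  sumOver-+ (x ∷ xs) f g rewrite sumOver-+ xs f g =
    solve 4 (λ a b c d → (a :+ b) :+ (c :+ d) := (a :+ c) :+ (b :+ d)) refl (f x) (g x) (sumOver xs f) (sumOver xs g)
    where open +-*-Solver

  sumOver-*ˡ : ∀ (xs : List A) c (f : A → ℤ) → sumOver xs (λ x → c * f x) ≡ c * sumOver xs f
  sumOver-*ˡ []       c f = sym (ℤₚ.*-zeroʳ c)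
  sumOver-*ˡ (x ∷ xs) c f rewrite sumOver-*ˡ xs c f = sym (ℤₚ.*-distribˡ-+ c (f x) (sumOver xs f))

  sumOver-*ʳ : ∀ (xs : List A) c (f : A → ℤ) → sumOver xs (λ x → f x * c) ≡ sumOver xs f * c
  sumOver-*ʳ xs c f = begin
    sumOver xs (λ x → f x * c)  ≡⟨ sumOver-cong xs (λ x _ → ℤₚ.*-comm (f x) c) ⟩
    sumOver xs (λ x → c * f x)  ≡⟨ sumOver-*ˡ xs c f ⟩
    c * sumOver xs f            ≡⟨ ℤₚ.*-comm c _ ⟩
    sumOver xs f * c            ∎
    where open ≡-Reasoning

  sumOver-neg : ∀ (xs : List A) (f : A → ℤ) → sumOver xs (λ x → - f x) ≡ - sumOver xs f
  sumOver-neg []       f = refl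
  sumOver-neg (x ∷ xs) f rewrite sumOver-neg xs f = sym (ℤₚ.neg-distrib-+ (f x) (sumOver xs f))

  sumOver-single : ∀ {xs : List A} (f : A → ℤ) {v} → Unique xs → v ∈ xs →
                   (∀ x → x ∈ xs → x ≢ v → f x ≡ 0ℤ) → sumOver xs f ≡ f v
  sumOver-single {x ∷ xs} f (x∉ ∷ _) (here refl) others = begin
    f x + sumOver xs f
      ≡⟨ cong (f x +_) (sumOver-zero xs (λ y y∈ → others y (there y∈) (All.lookup x∉ y∈ ∘ sym))) ⟩
    f x + 0ℤ
      ≡⟨ ℤₚ.+-identityʳ (f x) ⟩
    f x ∎
    where open ≡-Reasoning
  sumOver-single {x ∷ xs} f (x∉ ∷ u) (there v∈) others =
    trans (cong₂ _+_ (others x (here refl) (All.lookup x∉ v∈)) (sumOver-single f u v∈ (λ y → others y ∘ there)))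
          (ℤₚ.+-identityˡ _)

  sumOver-pair : ∀ {xs : List A} (f : A → ℤ) {u v} → Unique xs → u ∈ xs → v ∈ xs → u ≢ v →
                 (∀ x → x ∈ xs → x ≢ u → x ≢ v → f x ≡ 0ℤ) → sumOver xs f ≡ f u + f v
  sumOver-pair f _ (here refl) (here refl) u≢v _ = contradiction refl u≢v
  sumOver-pair {x ∷ xs} f (x∉ ∷ u) (here refl) (there v∈) _ others =
    cong (f x +_) (sumOver-single f u v∈ (λ y y∈ → others y (there y∈) (All.lookup x∉ y∈ ∘ sym)))
  sumOver-pair {x ∷ xs} f (x∉ ∷ u) (there u∈) (here refl) _ others =
    trans (cong (f x +_) (sumOver-single f u u∈ (λ y y∈ y≢u →
                             others y (there y∈) y≢u (All.lookup x∉ y∈ ∘ sym))))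
          (ℤₚ.+-comm (f x) _)
  sumOver-pair {x ∷ xs} f (x∉ ∷ u) (there u∈) (there v∈) u≢v others =
    trans (cong₂ _+_ (others x (here refl) (All.lookup x∉ u∈) (All.lookup x∉ v∈))
                     (sumOver-pair f u u∈ v∈ u≢v (λ y → others y ∘ there)))
          (ℤₚ.+-identityˡ _)

  sumOver≡0⇒otherNonzero : DecidableEquality A → ∀ {xs : List A} {f : A → ℤ} {x} → Unique xs →
    sumOver xs f ≡ 0ℤ → x ∈ xs → f x ≢ 0ℤ → ∃[ y ] (y ∈ xs × y ≢ x × f y ≢ 0ℤ)
  sumOver≡0⇒otherNonzero _≟_ {xs} {f} {x} u sum≡0 x∈ fx≢0
    with any? (λ y → ¬? (y ≟ x) ×-dec ¬? (f y ℤₚ.≟ 0ℤ)) xs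
  ... | yes found = let y , y∈ , y≢x , fy≢0 = find found in y , y∈ , y≢x , fy≢0
  ... | no  none  = contradiction (trans (sym (sumOver-single f u x∈ others)) sum≡0) fx≢0
    where
    others : ∀ y → y ∈ xs → y ≢ x → f y ≡ 0ℤ
    others y y∈ y≢x with f y ℤₚ.≟ 0ℤ
    ... | yes fy≡0 = fy≡0
    ... | no  fy≢0 = contradiction (lose y∈ (y≢x , fy≢0)) none

sumOver-comm : ∀ {A B : Set} (xs : List A) (ys : List B) (F : A → B → ℤ) →
               sumOver xs (λ x → sumOver ys (F x)) ≡ sumOver ys (λ y → sumOver xs (λ x → F x y))
sumOver-comm []       ys F = sym (sumOver-zero ys (λ _ _ → refl))
sumOver-comm (x ∷ xs) ys F rewrite sumOver-comm xs ys F = sym (sumOver-+ ys (F x) _)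

_≟ˢ_ : DecidableEquality Simplex
_≟ˢ_ = Listₚ.≡-dec ℕ._≟_

δ : Simplex → Simplex → ℤ
δ σ τ with σ ≟ˢ τ
... | yes _ = 1ℤ
... | no  _ = 0ℤ

δ-refl : ∀ σ → δ σ σ ≡ 1ℤ
δ-refl σ with σ ≟ˢ σ
... | yes _   = refl
... | no  σ≢σ = contradiction refl σ≢σ

δ-≢ : ∀ {σ τ} → σ ≢ τ → δ σ τ ≡ 0ℤ
δ-≢ {σ} {τ} σ≢τ with σ ≟ˢ τ
... | yes σ≡τ = contradiction σ≡τ σ≢τ
... | no  _   = refl

δ≢0⇒≡ : ∀ {σ τ} → δ σ τ ≢ 0ℤ → σ ≡ τ
δ≢0⇒≡ {σ} {τ} δ≢0 with σ ≟ˢ τ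
... | yes σ≡τ = σ≡τ
... | no  _   = contradiction refl δ≢0

δ-∷ : ∀ x σ τ → δ (x ∷ σ) (x ∷ τ) ≡ δ σ τ
δ-∷ x σ τ = by-cases (σ ≟ˢ τ)
  where
  by-cases : Dec (σ ≡ τ) → δ (x ∷ σ) (x ∷ τ) ≡ δ σ τ
  by-cases (yes refl) = trans (δ-refl (x ∷ σ)) (sym (δ-refl σ))
  by-cases (no σ≢τ)   = trans (δ-≢ (σ≢τ ∘ proj₂ ∘ Listₚ.∷-injective)) (sym (δ-≢ σ≢τ))

-- faceSum σ f = Σᵢ (-1)ⁱ f (removeAt σ i), computed by peeling off the first vertex.
faceSum : Simplex → (Simplex → ℤ) → ℤ
faceSum []      f = 0ℤ
faceSum (x ∷ σ) f = f σ - faceSum σ (λ τ → f (x ∷ τ))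

faceSum-cong : ∀ σ {f g : Simplex → ℤ} → (∀ i → f (removeAt σ i) ≡ g (removeAt σ i)) → faceSum σ f ≡ faceSum σ g
faceSum-cong []      _   = refl
faceSum-cong (x ∷ σ) f≗g = cong₂ _-_ (f≗g Fin.zero) (faceSum-cong σ (f≗g ∘ Fin.suc))

faceSum-zero : ∀ σ {f : Simplex → ℤ} → (∀ i → f (removeAt σ i) ≡ 0ℤ) → faceSum σ f ≡ 0ℤ
faceSum-zero []      _   = refl
faceSum-zero (x ∷ σ) f≗0 = cong₂ _-_ (f≗0 Fin.zero) (faceSum-zero σ (f≗0 ∘ Fin.suc))

faceSum-+ : ∀ σ (f g : Simplex → ℤ) → faceSum σ (λ τ → f τ + g τ) ≡ faceSum σ f + faceSum σ g
faceSum-+ []      f g = refl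
faceSum-+ (x ∷ σ) f g rewrite faceSum-+ σ (f ∘ (x ∷_)) (g ∘ (x ∷_)) =
  solve 4 (λ a b c d → (a :+ b) :- (c :+ d) := (a :- c) :+ (b :- d)) refl (f σ) (g σ) _ _
  where open +-*-Solver

faceSum-- : ∀ σ (f g : Simplex → ℤ) → faceSum σ (λ τ → f τ - g τ) ≡ faceSum σ f - faceSum σ g
faceSum-- []      f g = refl
faceSum-- (x ∷ σ) f g rewrite faceSum-- σ (f ∘ (x ∷_)) (g ∘ (x ∷_)) =
  solve 4 (λ a b c d → (a :- b) :- (c :- d) := (a :- c) :- (b :- d)) refl (f σ) (g σ) _ _
  where open +-*-Solver

faceSum-*ʳ : ∀ σ (f : Simplex → ℤ) c → faceSum σ (λ τ → f τ * c) ≡ faceSum σ f * c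
faceSum-*ʳ []      f c = refl
faceSum-*ʳ (x ∷ σ) f c rewrite faceSum-*ʳ σ (f ∘ (x ∷_)) c =
  solve 3 (λ a b c → a :* c :- b :* c := (a :- b) :* c) refl (f σ) _ c
  where open +-*-Solver

sumOver-faceSum : ∀ {A : Set} (xs : List A) σ (F : Simplex → A → ℤ) →
                  sumOver xs (λ y → faceSum σ (λ τ → F τ y)) ≡ faceSum σ (λ τ → sumOver xs (F τ))
sumOver-faceSum []       σ F = sym (faceSum-zero σ (λ _ → refl))
sumOver-faceSum (y ∷ xs) σ F rewrite sumOver-faceSum xs σ F = sym (faceSum-+ σ (λ τ → F τ y) _)

faceSum-faceSum : ∀ σ (f : Simplex → ℤ) → faceSum σ (λ τ → faceSum τ f) ≡ 0ℤ
faceSum-faceSum []      f = refl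
faceSum-faceSum (x ∷ σ) f = begin
  faceSum σ f - faceSum σ (λ τ → f τ - faceSum τ (f ∘ (x ∷_)))
    ≡⟨ cong (λ w → faceSum σ f - w) (faceSum-- σ f (λ τ → faceSum τ (f ∘ (x ∷_)))) ⟩
  faceSum σ f - (faceSum σ f - faceSum σ (λ τ → faceSum τ (f ∘ (x ∷_))))
    ≡⟨ cong (λ w → faceSum σ f - (faceSum σ f - w)) (faceSum-faceSum σ (f ∘ (x ∷_))) ⟩
  faceSum σ f - (faceSum σ f - 0ℤ)
    ≡⟨ solve 1 (λ a → a :- (a :- con 0ℤ) := con 0ℤ) refl (faceSum σ f) ⟩
  0ℤ ∎
  where
  open ≡-Reasoning
  open +-*-Solver

faceSum≢0⇒face : ∀ σ (f : Simplex → ℤ) → faceSum σ f ≢ 0ℤ → ∃[ i ] (f (removeAt σ i) ≢ 0ℤ)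
faceSum≢0⇒face []      f sum≢0 = contradiction refl sum≢0
faceSum≢0⇒face (x ∷ σ) f sum≢0 with f σ ℤₚ.≟ 0ℤ
... | no  fσ≢0 = Fin.zero , fσ≢0
... | yes fσ≡0 =
  let i , fxi≢0 = faceSum≢0⇒face σ (f ∘ (x ∷_)) (λ rest≡0 → sum≢0 (cong₂ _-_ fσ≡0 rest≡0))
  in Fin.suc i , fxi≢0

sumOver-allFin-suc : ∀ n (h : Fin (suc n) → ℤ) →
                     sumOver (allFin (suc n)) h ≡ h Fin.zero + sumOver (allFin n) (h ∘ Fin.suc)
sumOver-allFin-suc n h = cong (h Fin.zero +_) (cong sumℤ
  (trans (Listₚ.map-tabulate Fin.suc h) (sym (Listₚ.map-tabulate (λ i → i) (h ∘ Fin.suc)))))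

signedSum≡faceSum : ∀ σ (f : Simplex → ℤ) →
  sumOver (allFin (length σ)) (λ i → sign (toℕ i) * f (removeAt σ i)) ≡ faceSum σ f
signedSum≡faceSum []      f = refl
signedSum≡faceSum (x ∷ σ) f = begin
  sumOver (allFin (suc (length σ))) (λ i → sign (toℕ i) * f (removeAt (x ∷ σ) i))
    ≡⟨ sumOver-allFin-suc (length σ) (λ i → sign (toℕ i) * f (removeAt (x ∷ σ) i)) ⟩
  1ℤ * f σ + sumOver (allFin (length σ)) (λ i → - sign (toℕ i) * f (x ∷ removeAt σ i))
    ≡⟨ cong₂ _+_ (ℤₚ.*-identityˡ (f σ))
                 (sumOver-cong (allFin (length σ)) (λ i _ → sym (ℤₚ.neg-distribˡ-* (sign (toℕ i)) _))) ⟩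
  f σ + sumOver (allFin (length σ)) (λ i → - (sign (toℕ i) * f (x ∷ removeAt σ i)))
    ≡⟨ cong (f σ +_) (sumOver-neg (allFin (length σ)) _) ⟩
  f σ - sumOver (allFin (length σ)) (λ i → sign (toℕ i) * f (x ∷ removeAt σ i))
    ≡⟨ cong (λ w → f σ - w) (signedSum≡faceSum σ (f ∘ (x ∷_))) ⟩
  faceSum (x ∷ σ) f ∎
  where open ≡-Reasoning

-- The summand of `incidence` is local to its where-block; unification names it for us.
private
  incidenceSummand : ∀ σ τ → Σ (Fin (length σ) → ℤ) λ t → incidence σ τ ≡ sumOver (allFin (length σ)) t
  incidenceSummand σ τ = _ , refl

incidence≡faceSum : ∀ σ τ → incidence σ τ ≡ faceSum σ (λ ρ → δ ρ τ)
incidence≡faceSum σ τ =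
  trans (proj₂ (incidenceSummand σ τ))
        (trans (sumOver-cong (allFin (length σ)) (λ i _ → summand i)) (signedSum≡faceSum σ (λ ρ → δ ρ τ)))
  where
  summand : ∀ i → proj₁ (incidenceSummand σ τ) i ≡ sign (toℕ i) * δ (removeAt σ i) τ
  summand i with removeAt σ i ≟ˢ τ
  ... | yes _ = sym (ℤₚ.*-identityʳ (sign (toℕ i)))
  ... | no  _ = sym (ℤₚ.*-zeroʳ (sign (toℕ i)))

faceSum-incidence : ∀ σ α → faceSum σ (λ τ → incidence τ α) ≡ 0ℤ
faceSum-incidence σ α =
  trans (faceSum-cong σ (λ i → incidence≡faceSum (removeAt σ i) α)) (faceSum-faceSum σ (λ ρ → δ ρ α))

Sorted : Simplex → Set
Sorted = AllPairs _<_

canonical⇒sorted : ∀ {σ} → Canonical σ → Sorted σ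
canonical⇒sorted = Linked⇒AllPairs ℕₚ.<-trans

head-∉ : ∀ {x σ} → All (x <_) σ → x ∉ σ
head-∉ x<σ x∈σ = ℕₚ.<-irrefl refl (All.lookup x<σ x∈σ)

∈-∷⇒∈ : ∀ {x y σ} → y ∈ x ∷ σ → x < y → y ∈ σ
∈-∷⇒∈ (here refl) x<x = contradiction x<x (ℕₚ.<-irrefl refl)
∈-∷⇒∈ (there y∈σ) _   = y∈σ

⊆ˢ⇒sublist : ∀ {τ σ} → Sorted τ → Sorted σ → τ ⊆ˢ σ → τ Sublist.⊆ σ
⊆ˢ⇒sublist {[]}    {[]}    _ _ _ = Sublist.[]
⊆ˢ⇒sublist {y ∷ τ} {[]}    _ _ τ⊆σ with τ⊆σ y (here refl)
... | ()
⊆ˢ⇒sublist {[]}    {x ∷ σ} _ (_ ∷ sσ) _ = x Sublist.∷ʳ ⊆ˢ⇒sublist [] sσ (λ _ ())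
⊆ˢ⇒sublist {y ∷ τ} {x ∷ σ} (y<τ ∷ sτ) (x<σ ∷ sσ) τ⊆σ with τ⊆σ y (here refl)
... | here refl =
  refl Sublist.∷ ⊆ˢ⇒sublist sτ sσ (λ z z∈τ → ∈-∷⇒∈ (τ⊆σ z (there z∈τ)) (All.lookup y<τ z∈τ))
... | there y∈σ = x Sublist.∷ʳ ⊆ˢ⇒sublist (y<τ ∷ sτ) sσ y∷τ⊆σ
  where
  y∷τ⊆σ : (y ∷ τ) ⊆ˢ σ
  y∷τ⊆σ z (here refl) = y∈σ
  y∷τ⊆σ z (there z∈τ) = ∈-∷⇒∈ (τ⊆σ z (there z∈τ)) (ℕₚ.<-trans (All.lookup x<σ y∈σ) (All.lookup y<τ z∈τ))

sublist-length≡⇒≡ : ∀ {τ σ : Simplex} → τ Sublist.⊆ σ → length τ ≡ length σ → τ ≡ σ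
sublist-length≡⇒≡ τ⊑σ len = ≋⇒≡ (Sublistₚ.to-≋ len τ⊑σ)

⊊ˢ⇒length< : ∀ {τ σ} → Sorted τ → Sorted σ → τ ⊊ˢ σ → length τ < length σ
⊊ˢ⇒length< {τ} {σ} sτ sσ (τ⊆σ , τ≢σ) =
  ℕₚ.≤∧≢⇒< (Sublistₚ.length-mono-≤ τ⊑σ) (τ≢σ ∘ sublist-length≡⇒≡ τ⊑σ)
  where
  τ⊑σ : τ Sublist.⊆ σ
  τ⊑σ = ⊆ˢ⇒sublist sτ sσ τ⊆σ

faceSum-δ-facet : ∀ {τ σ} → Sorted σ → τ Sublist.⊆ σ → length σ ≡ suc (length τ) →
                  IsUnit (faceSum σ (λ ρ → δ ρ τ))
faceSum-δ-facet {τ} {x ∷ σ} (x<σ ∷ _) (.x Sublist.∷ʳ τ⊑σ) len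
  with sublist-length≡⇒≡ τ⊑σ (sym (ℕₚ.suc-injective len))
... | refl =
  inj₁ (cong₂ _-_ (δ-refl σ) (faceSum-zero σ (λ _ → δ-≢ (λ x∷ρ≡σ → head-∉ x<σ (subst (x ∈_) x∷ρ≡σ (here refl))))))
faceSum-δ-facet {x ∷ τ} {x ∷ σ} (x<σ ∷ sσ) (refl Sublist.∷ τ⊑σ) len =
  subst IsUnit (sym value) (IsUnit-neg (faceSum-δ-facet sσ τ⊑σ (ℕₚ.suc-injective len)))
  where
  value : faceSum (x ∷ σ) (λ ρ → δ ρ (x ∷ τ)) ≡ - faceSum σ (λ ρ → δ ρ τ)
  value = trans (cong₂ _-_ (δ-≢ (λ σ≡x∷τ → head-∉ x<σ (subst (x ∈_) (sym σ≡x∷τ) (here refl))))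
                           (faceSum-cong σ (λ i → δ-∷ x (removeAt σ i) τ)))
                (ℤₚ.+-identityˡ _)

incidence-facet : ∀ {σ τ} → Canonical σ → Canonical τ → Facet τ σ → IsUnit (incidence σ τ)
incidence-facet {σ} {τ} cσ cτ (τ⊆σ , len) =
  subst IsUnit (sym (incidence≡faceSum σ τ))
               (faceSum-δ-facet sσ (⊆ˢ⇒sublist (canonical⇒sorted cτ) sσ τ⊆σ) len)
  where
  sσ : Sorted σ
  sσ = canonical⇒sorted cσ

removeAt-⊆ˢ : ∀ σ i → removeAt σ i ⊆ˢ σ
removeAt-⊆ˢ (x ∷ σ) Fin.zero    y y∈        = there y∈
removeAt-⊆ˢ (x ∷ σ) (Fin.suc i) y (here y≡x) = here y≡x
removeAt-⊆ˢ (x ∷ σ) (Fin.suc i) y (there y∈) = there (removeAt-⊆ˢ σ i y y∈)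

All-removeAt : ∀ {P : ℕ → Set} σ i → All P σ → All P (removeAt σ i)
All-removeAt (x ∷ σ) Fin.zero    (_  ∷ Pσ) = Pσ
All-removeAt (x ∷ σ) (Fin.suc i) (Px ∷ Pσ) = Px ∷ All-removeAt σ i Pσ

removeAt-sorted : ∀ σ i → Sorted σ → Sorted (removeAt σ i)
removeAt-sorted (x ∷ σ) Fin.zero    (_   ∷ sσ) = sσ
removeAt-sorted (x ∷ σ) (Fin.suc i) (x<σ ∷ sσ) = All-removeAt σ i x<σ ∷ removeAt-sorted σ i sσ

_⊆ˢ?_ : (τ σ : Simplex) → Dec (τ ⊆ˢ σ)
τ ⊆ˢ? σ = map′ (λ τ⊆σ x → τ⊆σ {x}) (λ τ⊆σ {x} → τ⊆σ x) (τ ⊆? σ)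

IsDim⇒≢[] : ∀ {q σ} → IsDim q σ → σ ≢ []
IsDim⇒≢[] σ-dim refl = ℕₚ.0≢1+n σ-dim

dim-≢ : ∀ {p q σ τ} → IsDim p σ → IsDim q τ → p ≢ q → σ ≢ τ
dim-≢ σ-dim τ-dim p≢q refl = p≢q (ℕₚ.suc-injective (trans (sym σ-dim) τ-dim))

facet⇒⊊ˢ : ∀ {τ σ} → Facet τ σ → τ ⊊ˢ σ
facet⇒⊊ˢ (τ⊆σ , len) = τ⊆σ , λ τ≡σ → ℕₚ.1+n≢n (sym (trans (cong length τ≡σ) len))

incidence≢0⇒facet : ∀ {σ τ} → incidence σ τ ≢ 0ℤ → Facet τ σ
incidence≢0⇒facet {σ} {τ} inc≢0 with faceSum≢0⇒face σ (λ ρ → δ ρ τ) (inc≢0 ∘ trans (incidence≡faceSum σ τ))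
... | i , δ≢0 with δ≢0⇒≡ δ≢0
...   | refl = removeAt-⊆ˢ σ i , Listₚ.length-removeAt′ σ i

incidence-vertex : ∀ {v} → IsDim 0 v → incidence v [] ≡ 1ℤ
incidence-vertex {_ ∷ []} _ = refl

module _ (K : Complex) where

  ∈dSimplices⁻ : ∀ {q σ} → σ ∈ dSimplices K q → σ ∈ simplices K × IsDim q σ
  ∈dSimplices⁻ {q} = ∈ₚ.∈-filter⁻ (λ σ → length σ ℕ.≟ suc q)

  ∈dSimplices⁺ : ∀ {q σ} → σ ∈ simplices K → IsDim q σ → σ ∈ dSimplices K q
  ∈dSimplices⁺ {q} = ∈ₚ.∈-filter⁺ (λ σ → length σ ℕ.≟ suc q)

  dSimplices-unique : ∀ q → Unique (dSimplices K q)
  dSimplices-unique q = Uniqueₚ.filter⁺ (λ σ → length σ ℕ.≟ suc q) (distinct K)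

  face∈dSimplices : ∀ {q σ} → σ ∈ dSimplices K (suc q) → ∀ i → removeAt σ i ∈ dSimplices K q
  face∈dSimplices {q} {σ} σ∈ i =
    ∈dSimplices⁺ face∈K (ℕₚ.suc-injective (trans (sym (Listₚ.length-removeAt′ σ i)) σ-dim))
    where
    σ∈K : σ ∈ simplices K
    σ∈K = proj₁ (∈dSimplices⁻ σ∈)
    σ-dim : IsDim (suc q) σ
    σ-dim = proj₂ (∈dSimplices⁻ σ∈)
    face∈K : removeAt σ i ∈ simplices K
    face∈K = closed K σ (removeAt σ i) σ∈K
               (AllPairs⇒Linked (removeAt-sorted σ i (canonical⇒sorted (canonical K σ σ∈K)))) (removeAt-⊆ˢ σ i)

  incidence-incidence≡0 : ∀ {q σ} → σ ∈ dSimplices K (suc q) → ∀ α →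
    sumOver (dSimplices K q) (λ τ → incidence σ τ * incidence τ α) ≡ 0ℤ
  incidence-incidence≡0 {q} {σ} σ∈ α = begin
    sumOver E (λ τ → incidence σ τ * incidence τ α)
      ≡⟨ sumOver-cong E (λ τ _ → trans (cong (_* incidence τ α) (incidence≡faceSum σ τ))
                                       (sym (faceSum-*ʳ σ (λ ρ → δ ρ τ) (incidence τ α)))) ⟩
    sumOver E (λ τ → faceSum σ (λ ρ → δ ρ τ * incidence τ α))
      ≡⟨ sumOver-faceSum E σ (λ ρ τ → δ ρ τ * incidence τ α) ⟩
    faceSum σ (λ ρ → sumOver E (λ τ → δ ρ τ * incidence τ α))
      ≡⟨ faceSum-cong σ (λ i → select-face (face∈dSimplices σ∈ i)) ⟩
    faceSum σ (λ ρ → incidence ρ α)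
      ≡⟨ faceSum-incidence σ α ⟩
    0ℤ ∎
    where
    open ≡-Reasoning
    E : List Simplex
    E = dSimplices K q
    select-face : ∀ {ρ} → ρ ∈ E → sumOver E (λ τ → δ ρ τ * incidence τ α) ≡ incidence ρ α
    select-face {ρ} ρ∈ = begin
      sumOver E (λ τ → δ ρ τ * incidence τ α)
        ≡⟨ sumOver-single (λ τ → δ ρ τ * incidence τ α) (dSimplices-unique q) ρ∈
                          (λ τ _ τ≢ρ → cong (_* incidence τ α) (δ-≢ (τ≢ρ ∘ sym))) ⟩
      δ ρ ρ * incidence ρ α
        ≡⟨ cong (_* incidence ρ α) (δ-refl ρ) ⟩
      1ℤ * incidence ρ α
        ≡⟨ ℤₚ.*-identityˡ _ ⟩
      incidence ρ α ∎

  boundary∘boundary≡0 : ∀ q (c : Simplex → ℤ) α →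
    sumOver (dSimplices K q) (λ τ → boundaryCoeff K (suc q) c τ * incidence τ α) ≡ 0ℤ
  boundary∘boundary≡0 q c α = begin
    sumOver E (λ τ → sumOver D (λ σ → c σ * incidence σ τ) * incidence τ α)
      ≡⟨ sumOver-cong E (λ τ _ → sym (sumOver-*ʳ D (incidence τ α) (λ σ → c σ * incidence σ τ))) ⟩
    sumOver E (λ τ → sumOver D (λ σ → c σ * incidence σ τ * incidence τ α))
      ≡⟨ sumOver-comm E D (λ τ σ → c σ * incidence σ τ * incidence τ α) ⟩
    sumOver D (λ σ → sumOver E (λ τ → c σ * incidence σ τ * incidence τ α))
      ≡⟨ sumOver-zero D vanishes ⟩
    0ℤ ∎
    where
    open ≡-Reasoning
    D E : List Simplex
    D = dSimplices K (suc q)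
    E = dSimplices K q
    vanishes : ∀ σ → σ ∈ D → sumOver E (λ τ → c σ * incidence σ τ * incidence τ α) ≡ 0ℤ
    vanishes σ σ∈ = begin
      sumOver E (λ τ → c σ * incidence σ τ * incidence τ α)
        ≡⟨ sumOver-cong E (λ τ _ → ℤₚ.*-assoc (c σ) _ _) ⟩
      sumOver E (λ τ → c σ * (incidence σ τ * incidence τ α))
        ≡⟨ sumOver-*ˡ E (c σ) _ ⟩
      c σ * sumOver E (λ τ → incidence σ τ * incidence τ α)
        ≡⟨ cong (c σ *_) (incidence-incidence≡0 σ∈ α) ⟩
      c σ * 0ℤ
        ≡⟨ ℤₚ.*-zeroʳ (c σ) ⟩
      0ℤ ∎

InPair? : ∀ σ p → Dec (InPair σ p)
InPair? σ (α , β) = (σ ≟ˢ α) ⊎-dec (σ ≟ˢ β)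

module _ {K : Complex} (V : DiscreteVectorField K) where

  lowerPartner : Simplex → Simplex
  lowerPartner β = proj₁ (select (λ p → proj₂ p ≟ˢ β) ([] , []) (pairs V))

  lowerPartner-≡ : ∀ {α β} → (α , β) ∈ pairs V → lowerPartner β ≡ α
  lowerPartner-≡ {α} {β} αβ∈ with select-spec (λ p → proj₂ p ≟ˢ β) ([] , []) (lose αβ∈ refl)
  ... | p∈ , p₂≡β = cong proj₁ (atMostOne V β _ (α , β) p∈ αβ∈ (inj₂ (sym p₂≡β)) (inj₂ refl))

  lowerPartner-∈ : ∀ {α β} → (α , β) ∈ pairs V → (lowerPartner β , β) ∈ pairs V
  lowerPartner-∈ {β = β} αβ∈ = subst (λ α → (α , β) ∈ pairs V) (sym (lowerPartner-≡ αβ∈)) αβ∈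

  -- b, α, β may occur in this order in a V-trajectory.
  TrajectoryStep : Simplex → Simplex → Set
  TrajectoryStep b β = ∃[ α ] ((α , β) ∈ pairs V × α ⊊ˢ b × b ≢ β)

  module _ (gradient : Gradient V) where

    gradient⇒noReturn : ∀ q (f : ℕ → Simplex) k a →
      (∀ m → m ≤ suc k ℕ.+ a → IsDim q (f m) × TrajectoryStep (f (suc m)) (f m)) → f (suc k ℕ.+ a) ≢ f a
    gradient⇒noReturn q f k a walk returns =
      gradient loop ((λ ()) , trans (proj₂ (proj₂ (proj₂ cycle))) (sym returns))
      where
      Segment : ℕ → Set
      Segment n = ∃[ ps ] (Steps V (f (n ℕ.+ a)) ps × SameDim (suc q) ps × endOf (f (n ℕ.+ a)) ps ≡ f a)

      segment : ∀ n → n ℕ.+ a ≤ suc k ℕ.+ a → Segment n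
      segment zero    _       = [] , done , [] , refl
      segment (suc n) n+a<end =
        let dim , α , αβ∈ , α⊊ , b≢β = walk (n ℕ.+ a) (ℕₚ.<⇒≤ n+a<end)
            ps , steps , same-dim , end = segment n (ℕₚ.<⇒≤ n+a<end)
        in (α , f (n ℕ.+ a)) ∷ ps , step αβ∈ α⊊ b≢β steps , dim ∷ same-dim , end

      cycle : Segment (suc k)
      cycle = segment (suc k) ℕₚ.≤-refl

      start-dim : IsDim q (f (suc k ℕ.+ a))
      start-dim = proj₁ (walk (suc k ℕ.+ a) ℕₚ.≤-refl)

      start∈K : f (suc k ℕ.+ a) ∈ simplices K
      start∈K = let _ , _ , αβ∈ , _ = walk (suc k ℕ.+ a) ℕₚ.≤-refl in proj₂ (pair-in V _ _ αβ∈)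

      loop : Trajectory V
      loop = record
        { β₀      = f (suc k ℕ.+ a)
        ; β₀∈K    = start∈K
        ; β₀-dim  = q , start-dim
        ; rest    = proj₁ cycle
        ; valid   = proj₁ (proj₂ cycle)
        ; samedim = subst (λ n → SameDim n (proj₁ cycle)) (sym start-dim) (proj₁ (proj₂ (proj₂ cycle)))
        }

    gradient⇒noLongBackwardWalk : ∀ (S : List Simplex) q (f : ℕ → Simplex) →
      (∀ m → m ≤ length S → f m ∈ S × IsDim q (f m) × TrajectoryStep (f (suc m)) (f m)) → ⊥
    gradient⇒noLongBackwardWalk S q f walk =
      let a , k , end≤|S| , returns = ∈-pigeonhole S f (λ m m≤ → proj₁ (walk m m≤))
      in gradient⇒noReturn q f k a (λ m m≤ → proj₂ (walk m (ℕₚ.≤-trans m≤ end≤|S|))) returns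

    gradient⇒noEndlessBackwardWalk : ∀ (S : List Simplex) q (P : Simplex → Set) →
      (∀ {β} → P β → β ∈ S × IsDim q β × ∃[ b ] (P b × TrajectoryStep b β)) → ∀ {β} → ¬ P β
    gradient⇒noEndlessBackwardWalk S q P back {β} Pβ =
      gradient⇒noLongBackwardWalk S q (proj₁ ∘ walk) (λ m _ →
        let β∈S , dim , _ , _ , b→β = back (proj₂ (walk m)) in β∈S , dim , b→β)
      where
      predecessor : Σ Simplex P → Σ Simplex P
      predecessor (γ , Pγ) = let _ , _ , b , Pb , _ = back Pγ in b , Pb
      walk : ℕ → Σ Simplex P
      walk = fold (β , Pβ) predecessor

Coface : Complex → ℕ → Simplex → Simplex → Set
Coface K d τ σ = σ ∈ simplices K × IsDim d σ × τ ⊆ˢ σ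

coface⇒facet : ∀ K {d τ σ} → length τ ≡ d → Coface K d τ σ → Facet τ σ
coface⇒facet _ τ-len (_ , σ-dim , τ⊆σ) = τ⊆σ , trans σ-dim (cong suc (sym τ-len))

distinct-covers : ∀ {A : Set} {a b x y z : A} →
  x ≡ a ⊎ x ≡ b → y ≡ a ⊎ y ≡ b → x ≢ y → z ≡ a ⊎ z ≡ b → z ≡ x ⊎ z ≡ y
distinct-covers (inj₁ refl) (inj₁ refl) x≢y _          = contradiction refl x≢y
distinct-covers (inj₂ refl) (inj₂ refl) x≢y _          = contradiction refl x≢y
distinct-covers (inj₁ refl) (inj₂ refl) _   (inj₁ refl) = inj₁ refl
distinct-covers (inj₁ refl) (inj₂ refl) _   (inj₂ refl) = inj₂ refl
distinct-covers (inj₂ refl) (inj₁ refl) _   (inj₁ refl) = inj₂ refl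
distinct-covers (inj₂ refl) (inj₁ refl) _   (inj₂ refl) = inj₁ refl

module _ {K : Complex} {d : ℕ} (M : Pseudomanifold K d) where

  pseudomanifold-length≤ : ∀ {σ} → σ ∈ simplices K → length σ ≤ suc d
  pseudomanifold-length≤ {σ} σ∈K =
    subst (length σ ≤_) longest-dim (All.lookup (f[xs]≤f[argmax] [] (simplices K)) σ∈K)
    where
    longest : Simplex
    longest = argmax length [] (simplices K)

    longest∈K : longest ∈ simplices K
    longest∈K with argmax-sel length [] (simplices K)
    ... | inj₂ ∈K     = ∈K
    ... | inj₁ ≡empty =
      let ρ , ρ∈K = nonempty K in subst (_∈ simplices K) (sym ≡empty) (closed K ρ [] ρ∈K Linked.[] (λ _ ()))

    longest-maximal : Maximal K longest
    longest-maximal = longest∈K , λ τ τ∈K longest⊊τ →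
      ℕₚ.<⇒≱ (⊊ˢ⇒length< (canonical⇒sorted (canonical K _ longest∈K)) (canonical⇒sorted (canonical K τ τ∈K))
                         longest⊊τ)
             (All.lookup (f[xs]≤f[argmax] [] (simplices K)) τ∈K)

    longest-dim : length longest ≡ suc d
    longest-dim = pure M longest longest-maximal

  module _ {τ} (τ∈K : τ ∈ simplices K) (τ-len : length τ ≡ d) where

    otherCoface : ∀ {σ} → Coface K d τ σ → ∃[ σ′ ] (Coface K d τ σ′ × σ′ ≢ σ)
    otherCoface {σ} (σ∈K , σ-dim , τ⊆σ) with twoCofaces M τ τ∈K τ-len
    ... | σ₁ , σ₂ , σ₁∈ , σ₁-dim , τ⊆σ₁ , σ₂∈ , σ₂-dim , τ⊆σ₂ , σ₁≢σ₂ , cover with cover σ σ∈K σ-dim τ⊆σ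
    ... | inj₁ refl = σ₂ , (σ₂∈ , σ₂-dim , τ⊆σ₂) , σ₁≢σ₂ ∘ sym
    ... | inj₂ refl = σ₁ , (σ₁∈ , σ₁-dim , τ⊆σ₁) , σ₁≢σ₂

    onlyTwoCofaces : ∀ {σ₁ σ₂ σ} → Coface K d τ σ₁ → Coface K d τ σ₂ → σ₁ ≢ σ₂ →
                     Coface K d τ σ → σ ≡ σ₁ ⊎ σ ≡ σ₂
    onlyTwoCofaces c₁ c₂ σ₁≢σ₂ c with twoCofaces M τ τ∈K τ-len
    ... | ρ₁ , ρ₂ , _ , _ , _ , _ , _ , _ , _ , cover =
      distinct-covers (covered c₁) (covered c₂) σ₁≢σ₂ (covered c)
      where
      covered : ∀ {σ} → Coface K d τ σ → σ ≡ ρ₁ ⊎ σ ≡ ρ₂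
      covered (σ∈K , σ-dim , τ⊆σ) = cover _ σ∈K σ-dim τ⊆σ

fold-shift : ∀ {A : Set} (s : A → A) x m → fold (s x) s m ≡ fold x s (suc m)
fold-shift s x m = trans (iterate-is-fold (s x) s m) (sym (iterate-is-fold x s (suc m)))

module SphereOrientation {K : Complex} {e : ℕ} (S : CombinatorialSphere K (suc e)) where
  open CombinatorialSphere S

  D E : List Simplex
  D = dSimplices K (suc e)
  E = dSimplices K e

  lower : Simplex → Simplex
  lower = lowerPartner V

  top-unpaired : ∀ p → p ∈ pairs V → ¬ InPair top p
  top-unpaired with proj₂ (proj₂ top-crit)
  ... | inj₁ unpaired        = unpaired
  ... | inj₂ (top-dim₀ , _) = contradiction (trans (sym top-dim) top-dim₀) λ ()

  noncritical⇒paired : ∀ {q σ} → σ ∈ simplices K → IsDim q σ → σ ≢ top → σ ≢ vertex →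
                       ∃[ p ] (p ∈ pairs V × InPair σ p)
  noncritical⇒paired {σ = σ} σ∈K σ-dim σ≢top σ≢vertex with any? (InPair? σ) (pairs V)
  ... | yes found = find found
  ... | no  none  with onlyTwo σ (σ∈K , IsDim⇒≢[] σ-dim , inj₁ (λ p p∈ σ∈p → none (lose p∈ σ∈p)))
  ...   | inj₁ σ≡top    = contradiction σ≡top σ≢top
  ...   | inj₂ σ≡vertex = contradiction σ≡vertex σ≢vertex

  across : Simplex → Simplex
  across β = select (λ σ → ¬? (σ ≟ˢ β) ×-dec (lower β ⊆ˢ? σ)) β D

  module Lower {β} (β∈D : β ∈ D) (β≢top : β ≢ top) where

    β∈K : β ∈ simplices K
    β∈K = proj₁ (∈dSimplices⁻ K β∈D)

    β-dim : IsDim (suc e) β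
    β-dim = proj₂ (∈dSimplices⁻ K β∈D)

    pair : (lower β , β) ∈ pairs V
    pair with noncritical⇒paired β∈K β-dim β≢top (dim-≢ β-dim vertex-dim λ ())
    ... | (α , γ) , p∈ , inj₂ refl = lowerPartner-∈ V p∈
    ... | (α , γ) , p∈ , inj₁ refl =
      contradiction (subst (_≤ suc (suc e)) γ-len (pseudomanifold-length≤ pseudo γ∈K)) (ℕₚ.<-irrefl refl)
      where
      γ∈K : γ ∈ simplices K
      γ∈K = proj₂ (pair-in V α γ p∈)
      γ-len : length γ ≡ suc (suc (suc e))
      γ-len = trans (proj₂ (facet V α γ p∈)) (cong suc β-dim)

    lower-facet : Facet (lower β) β
    lower-facet = facet V _ _ pair

    lower∈K : lower β ∈ simplices K
    lower∈K = proj₁ (pair-in V _ _ pair)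

    lower-len : length (lower β) ≡ suc e
    lower-len = ℕₚ.suc-injective (trans (sym (proj₂ lower-facet)) β-dim)

    β-coface : Coface K (suc e) (lower β) β
    β-coface = β∈K , β-dim , proj₁ lower-facet

    private
      across-spec : across β ∈ D × (across β ≢ β × lower β ⊆ˢ across β)
      across-spec with otherCoface pseudo lower∈K lower-len β-coface
      ... | σ , (σ∈K , σ-dim , lower⊆σ) , σ≢β =
        select-spec (λ σ → ¬? (σ ≟ˢ β) ×-dec (lower β ⊆ˢ? σ)) β
                    (lose (∈dSimplices⁺ K σ∈K σ-dim) (σ≢β , lower⊆σ))

    across∈D : across β ∈ D
    across∈D = proj₁ across-spec

    across≢β : across β ≢ β
    across≢β = proj₁ (proj₂ across-spec)

    across-coface : Coface K (suc e) (lower β) (across β)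
    across-coface =
      proj₁ (∈dSimplices⁻ K across∈D) , proj₂ (∈dSimplices⁻ K across∈D) , proj₂ (proj₂ across-spec)

    across-step : TrajectoryStep V (across β) β
    across-step = lower β , pair , facet⇒⊊ˢ (coface⇒facet K lower-len across-coface) , across≢β

    incidence-lower≡0 : ∀ {σ} → σ ∈ D → σ ≢ β → σ ≢ across β → incidence σ (lower β) ≡ 0ℤ
    incidence-lower≡0 {σ} σ∈D σ≢β σ≢across with incidence σ (lower β) ℤₚ.≟ 0ℤ
    ... | yes inc≡0 = inc≡0
    ... | no  inc≢0 with onlyTwoCofaces pseudo lower∈K lower-len β-coface across-coface (across≢β ∘ sym)
                           (proj₁ (∈dSimplices⁻ K σ∈D) , proj₂ (∈dSimplices⁻ K σ∈D) ,
                            proj₁ (incidence≢0⇒facet inc≢0))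
    ...   | inj₁ σ≡β      = contradiction σ≡β σ≢β
    ...   | inj₂ σ≡across = contradiction σ≡across σ≢across

    β-incidence-unit : IsUnit (incidence β (lower β))
    β-incidence-unit = incidence-facet (canonical K _ β∈K) (canonical K _ lower∈K) lower-facet

    across-incidence-unit : IsUnit (incidence (across β) (lower β))
    across-incidence-unit = incidence-facet (canonical K _ (proj₁ across-coface)) (canonical K _ lower∈K)
                                            (coface⇒facet K lower-len across-coface)

  open Lower using (across∈D)

  -- Chosen so that β and across β induce opposite orientations on their common facet lower β.
  transitionSign : Simplex → ℤ
  transitionSign β = - (incidence (across β) (lower β) * incidence β (lower β))

  -- ξ n β is the product of the transition signs along β, across β, across² β, … up to top, within n steps.
  ξ : ℕ → Simplex → ℤ
  ξ zero    β = 1ℤ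
  ξ (suc n) β with β ≟ˢ top
  ... | yes _ = 1ℤ
  ... | no  _ = transitionSign β * ξ n (across β)

  ξ-top : ∀ n → ξ n top ≡ 1ℤ
  ξ-top zero = refl
  ξ-top (suc n) with top ≟ˢ top
  ... | yes _       = refl
  ... | no  top≢top = contradiction refl top≢top

  ξ-unit : ∀ n {β} → β ∈ D → IsUnit (ξ n β)
  ξ-unit zero    _ = inj₁ refl
  ξ-unit (suc n) {β} β∈D with β ≟ˢ top
  ... | yes _     = inj₁ refl
  ... | no  β≢top =
    IsUnit-* (IsUnit-neg (IsUnit-* (Lower.across-incidence-unit β∈D β≢top) (Lower.β-incidence-unit β∈D β≢top)))
             (ξ-unit n (across∈D β∈D β≢top))

  ξ-stable : ∀ m {n β} → fold β across m ≡ top → m ≤ n → ξ n β ≡ ξ m β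
  ξ-stable zero    {n}           refl  _         = ξ-top n
  ξ-stable (suc m) {suc n} {β} reach (ℕ.s≤s m≤n) with β ≟ˢ top
  ... | yes _ = refl
  ... | no  _ = cong (transitionSign β *_) (ξ-stable m (trans (fold-shift across β m) reach) m≤n)

  -- Otherwise across would run through |D| + 1 non-top d-simplices, closing a V-trajectory.
  reachesTop : ∀ {β} → β ∈ D → ∃[ m ] (m < suc (length D) × fold β across m ≡ top)
  reachesTop {β} β∈D with ℕₚ.anyUpTo? (λ m → fold β across m ≟ˢ top) (suc (length D))
  ... | yes found = found
  ... | no  never = ⊥-elim (gradient⇒noLongBackwardWalk V gradient D (suc e) (λ m → fold β across m) walk)
    where
    notTop : ∀ {m} → m ≤ length D → fold β across m ≢ top
    notTop m≤ reach = never (_ , ℕ.s≤s m≤ , reach)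

    chain∈D : ∀ m → m ≤ length D → fold β across m ∈ D
    chain∈D zero    _   = β∈D
    chain∈D (suc m) m< = across∈D (chain∈D m (ℕₚ.<⇒≤ m<)) (notTop (ℕₚ.<⇒≤ m<))

    walk : ∀ m → m ≤ length D → fold β across m ∈ D × IsDim (suc e) (fold β across m) ×
                                 TrajectoryStep V (fold β across (suc m)) (fold β across m)
    walk m m≤ =
      chain∈D m m≤ , proj₂ (∈dSimplices⁻ K (chain∈D m m≤)) , Lower.across-step (chain∈D m m≤) (notTop m≤)

  orientation : Simplex → ℤ
  orientation = ξ (suc (length D))

  orientation-unit : ∀ {β} → β ∈ D → IsUnit (orientation β)
  orientation-unit = ξ-unit (suc (length D))

  orientation-across : ∀ {β} → β ∈ D → β ≢ top → orientation β ≡ transitionSign β * orientation (across β)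
  orientation-across {β} β∈D β≢top with β ≟ˢ top
  ... | yes β≡top = contradiction β≡top β≢top
  ... | no  _     with reachesTop (across∈D β∈D β≢top)
  ...   | m , m<1+|D| , reach =
    cong (transitionSign β *_)
         (trans (ξ-stable m reach (ℕₚ.≤-pred m<1+|D|)) (sym (ξ-stable m reach (ℕₚ.<⇒≤ m<1+|D|))))

  ∂orientation : Simplex → ℤ
  ∂orientation = boundaryCoeff K (suc e) orientation

  ∂orientation-lower : ∀ {β} → β ∈ D → β ≢ top → ∂orientation (lower β) ≡ 0ℤ
  ∂orientation-lower {β} β∈D β≢top = begin
    sumOver D (λ σ → orientation σ * incidence σ τ)
      ≡⟨ sumOver-pair (λ σ → orientation σ * incidence σ τ) (dSimplices-unique K (suc e)) β∈D (across∈D β∈D β≢top)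
                      (Lower.across≢β β∈D β≢top ∘ sym) others ⟩
    orientation β * incidence β τ + orientation (across β) * incidence (across β) τ
      ≡⟨ cong (λ o → o * incidence β τ + orientation (across β) * incidence (across β) τ)
              (orientation-across β∈D β≢top) ⟩
    transitionSign β * orientation (across β) * incidence β τ + orientation (across β) * incidence (across β) τ
      ≡⟨ IsUnit-cancel (Lower.β-incidence-unit β∈D β≢top) (incidence (across β) τ) (orientation (across β)) ⟩
    0ℤ ∎
    where
    open ≡-Reasoning
    τ : Simplex
    τ = lower β
    others : ∀ σ → σ ∈ D → σ ≢ β → σ ≢ across β → orientation σ * incidence σ τ ≡ 0ℤ
    others σ σ∈D σ≢β σ≢across =
      trans (cong (orientation σ *_) (Lower.incidence-lower≡0 β∈D β≢top σ∈D σ≢β σ≢across))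
            (ℤₚ.*-zeroʳ (orientation σ))

  ∂orientation-upper : ∀ {τ β} → (τ , β) ∈ pairs V → IsDim e τ → ∂orientation τ ≡ 0ℤ
  ∂orientation-upper {τ} {β} τβ∈ τ-dim =
    subst (λ ρ → ∂orientation ρ ≡ 0ℤ) (lowerPartner-≡ V τβ∈) (∂orientation-lower β∈D β≢top)
    where
    β∈D : β ∈ D
    β∈D = ∈dSimplices⁺ K (proj₂ (pair-in V τ β τβ∈)) (trans (proj₂ (facet V τ β τβ∈)) (cong suc τ-dim))
    β≢top : β ≢ top
    β≢top β≡top = top-unpaired (τ , β) τβ∈ (inj₂ (sym β≡top))

  Support : Simplex → Set
  Support τ = τ ∈ E × ∂orientation τ ≢ 0ℤ

  support-dim : ∀ {τ} → Support τ → IsDim e τ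
  support-dim (τ∈E , _) = proj₂ (∈dSimplices⁻ K τ∈E)

  support⇒lowerPair : ∀ {τ} → Support τ → τ ≢ vertex → (lower τ , τ) ∈ pairs V
  support⇒lowerPair {τ} (τ∈E , ∂≢0) τ≢vertex
    with noncritical⇒paired (proj₁ (∈dSimplices⁻ K τ∈E)) (proj₂ (∈dSimplices⁻ K τ∈E))
                            (dim-≢ (proj₂ (∈dSimplices⁻ K τ∈E)) top-dim (ℕₚ.1+n≢n ∘ sym)) τ≢vertex
  ... | (α , γ) , p∈ , inj₁ refl = contradiction (∂orientation-upper p∈ (proj₂ (∈dSimplices⁻ K τ∈E))) ∂≢0
  ... | (α , γ) , p∈ , inj₂ refl = lowerPartner-∈ V p∈

  support-neighbour : ∀ {τ α} → Support τ → incidence τ α ≢ 0ℤ →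
                      ∃[ τ′ ] (Support τ′ × τ′ ≢ τ × incidence τ′ α ≢ 0ℤ)
  support-neighbour {τ} {α} (τ∈E , ∂≢0) inc≢0 =
    let τ′ , τ′∈E , τ′≢τ , prod≢0 = sumOver≡0⇒otherNonzero _≟ˢ_ (dSimplices-unique K e)
                                      (boundary∘boundary≡0 K e orientation α) τ∈E (*≢0 ∂≢0 inc≢0)
    in τ′ , (τ′∈E , *≢0⇒≢0ˡ {b = incidence τ′ α} prod≢0) , τ′≢τ , *≢0⇒≢0ʳ {∂orientation τ′} prod≢0

  -- A vertex paired with ∅ is critical, so for e = 0 the support can only contain the critical vertex.
  support-vertex : e ≡ 0 → ∀ {τ} → Support τ → τ ≡ vertex
  support-vertex e≡0 {τ} supp with τ ≟ˢ vertex
  ... | yes τ≡vertex = τ≡vertex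
  ... | no  τ≢vertex =
    [ (λ τ≡top → contradiction τ≡top (dim-≢ τ-dim₀ top-dim λ ())) , (λ τ≡vertex → contradiction τ≡vertex τ≢vertex) ]
      (onlyTwo τ (proj₁ (∈dSimplices⁻ K (proj₁ supp)) , IsDim⇒≢[] τ-dim₀ ,
                  inj₂ (τ-dim₀ , subst (λ α → (α , τ) ∈ pairs V) lower≡[] pair)))
    where
    τ-dim₀ : IsDim 0 τ
    τ-dim₀ = trans (support-dim supp) (cong suc e≡0)
    pair : (lower τ , τ) ∈ pairs V
    pair = support⇒lowerPair supp τ≢vertex
    length≡0⇒[] : ∀ {ρ : Simplex} → length ρ ≡ 0 → ρ ≡ []
    length≡0⇒[] {[]}    _  = refl
    length≡0⇒[] {_ ∷ _} ()
    lower≡[] : lower τ ≡ []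
    lower≡[] = length≡0⇒[] (ℕₚ.suc-injective (trans (sym (proj₂ (facet V _ _ pair))) τ-dim₀))

  -- Every vertex has incidence 1 with ∅, so ∂∂ = 0 at ∅ forbids a support consisting of one vertex.
  no-support-dim0 : e ≡ 0 → ∀ {τ} → ¬ Support τ
  no-support-dim0 e≡0 {τ} supp =
    let τ′ , τ′-supp , τ′≢τ , _ =
          support-neighbour {α = []} supp (IsUnit⇒≢0 (inj₁ (incidence-vertex {τ} τ-dim₀)))
    in τ′≢τ (trans (support-vertex e≡0 τ′-supp) (sym (support-vertex e≡0 supp)))
    where
    τ-dim₀ : IsDim 0 τ
    τ-dim₀ = trans (support-dim supp) (cong suc e≡0)

  support-predecessor : e ≢ 0 → ∀ {τ} → Support τ → ∃[ τ′ ] (Support τ′ × TrajectoryStep V τ′ τ)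
  support-predecessor e≢0 {τ} supp =
    let pair = support⇒lowerPair supp (dim-≢ (support-dim supp) vertex-dim e≢0)
        lower-unit = incidence-facet (canonical K _ (proj₁ (∈dSimplices⁻ K (proj₁ supp))))
                                     (canonical K _ (proj₁ (pair-in V _ _ pair))) (facet V _ _ pair)
        τ′ , τ′-supp , τ′≢τ , inc≢0 = support-neighbour supp (IsUnit⇒≢0 lower-unit)
    in τ′ , τ′-supp , lower τ , pair , facet⇒⊊ˢ (incidence≢0⇒facet inc≢0) , τ′≢τ

  no-support : ∀ {τ} → ¬ Support τ
  no-support with e ℕ.≟ 0
  ... | yes e≡0 = no-support-dim0 e≡0
  ... | no  e≢0 = gradient⇒noEndlessBackwardWalk V gradient E e Support
                    (λ supp → proj₁ supp , support-dim supp , support-predecessor e≢0 supp)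

  ∂orientation≡0 : ∀ {τ} → τ ∈ E → ∂orientation τ ≡ 0ℤ
  ∂orientation≡0 τ∈E = decidable-stable (_ ℤₚ.≟ 0ℤ) (λ ∂≢0 → no-support (τ∈E , ∂≢0))

theoremA2 : (K : Complex) (d : ℕ) → CombinatorialSphere K d → Orientable K d
theoremA2 K zero    S = (λ _ → 1ℤ) , (λ _ _ _ → inj₁ refl) , tt
theoremA2 K (suc e) S =
  orientation ,
  (λ σ σ∈K σ-dim → orientation-unit (∈dSimplices⁺ K σ∈K σ-dim)) ,
  (λ τ τ∈K τ-dim → ∂orientation≡0 (∈dSimplices⁺ K τ∈K τ-dim))
  where open SphereOrientation S
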